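{- Let $0\le f(n)\le n$ be an integer sequence. Its average order is at least linear if and only if there exists an integer sequence $N_t=k^t$, with $k>1$, such that the block-sums $F_t:=\sum_{n\in(N_t,N_{t+1}]}f(n)$ satisfy $F_t\ge cN_{t+1}^2$ for some constant $c>0$ and all sufficiently large $t$. Furthermore, $k$ can be chosen large enough that there exists some $\lambda\in(0,1)$ with $F_t\le\lambda F_{t+1}$ for all sufficiently large $t$.
   Context: "Average order at least linear" means there is $a>0$ with $\sum_{n=1}^N f(n)\ge a\sum_{n=1}^N n$ for all sufficiently large $N$. -}

module Defs where

open import Data.Nat as ℕ using (ℕ; zero; suc; _+_; _∸_; _^_)
import Data.Integer as ℤ
open import Data.Product using (Σ; _×_)
open import Data.Rational as ℚ using (ℚ; _/_; 0ℚ; 1ℚ)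

toℚ : ℕ → ℚ
toℚ n = ℤ.+ n / 1

S : (ℕ → ℕ) → ℕ → ℕ
S f zero = 0
S f (suc N) = S f N + f (suc N)

-- block sum F_t = Σ_{n ∈ (k^t, k^(t+1)]} f n  =  S f (k^(t+1)) − S f (k^t)
-- (truncated subtraction is exact here since k^t ≤ k^(t+1) for k ≥ 1 and S f is monotone)
F : (ℕ → ℕ) → ℕ → ℕ → ℕ
F f k t = S f (k ^ suc t) ∸ S f (k ^ t)

Eventually : (ℕ → Set) → Set
Eventually P = Σ ℕ λ n₀ → ∀ n → n₀ ℕ.≤ n → P n

AvgLinear : (ℕ → ℕ) → Set
AvgLinear f = Σ ℚ λ a → (0ℚ ℚ.< a) ×
  Eventually (λ N → a ℚ.* toℚ (S (λ n → n) N) ℚ.≤ toℚ (S f N))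

BlockLower : (ℕ → ℕ) → ℕ → Set
BlockLower f k = Σ ℚ λ c → (0ℚ ℚ.< c) ×
  Eventually (λ t → c ℚ.* toℚ ((k ^ suc t) ^ 2) ℚ.≤ toℚ (F f k t))

BlockRatio : (ℕ → ℕ) → ℕ → Set
BlockRatio f k = Σ ℚ λ l → (0ℚ ℚ.< l) × (l ℚ.< 1ℚ) ×
  Eventually (λ t → toℚ (F f k t) ℚ.≤ l ℚ.* toℚ (F f k (suc t)))

-- Write T N = 1 + 2 + ... + N, so that N²/2 ≤ T N ≤ N², and S f N for the
-- partial sums of f.  Every statement involved has the shape "c · m x ≤ n x
-- for all large x, for some rational c > 0"; clearing denominators turns it
-- into "m x ≤ Q · n x for all large x, for some natural Q" (NatLower), and
-- the whole proof is carried out in ℕ.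
--
--   ⇒  If T N ≤ Q · S f N eventually, take k = 4(Q+1) and N = k^(t+1).
--      Then k^(2t+2)/2 ≤ T N ≤ (Q+1)(F_t + S f (k^t)) ≤ (Q+1)(F_t + k^(2t)),
--      and the last term is small enough to give k^(2t+2) ≤ k · F_t.
--      Comparing with the trivial bound F_t ≤ k^(2t+2) gives 2 F_t ≤ F_(t+1).
--   ⇐  If k^(2t+2) ≤ Q · F_t eventually, bracket N between consecutive
--      powers k^(t+1) ≤ N < k^(t+2); then T N ≤ N² ≤ k² k^(2t+2) ≤ k² Q F_t
--      ≤ k² Q · S f N.
module Submission where

open import Defs
open import Data.Nat using (ℕ; _≤_; _<_)
open import Data.Product using (Σ; _×_)
open import Function.Bundles using (_⇔_)

open import Data.Nat using (zero; suc; _+_; _*_; _∸_; _^_; z≤n; s≤s; _<?_; NonZero)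
open import Data.Product using (_,_)
open import Data.Nat.Properties
open import Data.Nat.Tactic.RingSolver using (solve-∀)
open import Data.Nat.Coprimality as Coprimality using (Coprime)
import Data.Integer as ℤ
open import Data.Integer using (+_; +≤+; +<+)
import Data.Integer.Properties as ℤ
open import Data.Rational as ℚ using (ℚ; mkℚ; 0ℚ; ½)
import Data.Rational.Properties as ℚ
import Data.Rational.Unnormalised as ℚᵘ
import Data.Rational.Unnormalised.Properties as ℚᵘ
open import Data.Sign using (Sign)
open import Data.Sum using (inj₁; inj₂)
open import Relation.Nullary using (yes; no; contradiction)
open import Relation.Binary.PropositionalEquality
open import Function.Bundles using (mk⇔; Equivalence)

eventually-map : {P R : ℕ → Set} → (∀ x → P x → R x) → Eventually P → Eventually R
eventually-map imp (x₀ , ev) = x₀ , λ x x₀≤x → imp x (ev x x₀≤x)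

coprime-1 : ∀ n → Coprime n 1
coprime-1 n = Coprimality.sym (Coprimality.1-coprimeTo n)

toℚ-reduced : ∀ n → toℚ n ≡ mkℚ (+ n) 0 (coprime-1 n)
toℚ-reduced n = ℚ.normalize-coprime (coprime-1 n)

-- The unnormalised product (p/(1+d)) · (m/1) compared with n/1 is, after
-- cross-multiplication, the integer inequality p·m ≤ n·(1+d).
private
  numerator≡ : ∀ a → (Sign.+ ℤ.◃ a) ℤ.* + 1 ≡ + a
  numerator≡ a = trans (ℤ.*-identityʳ _) (ℤ.+◃n≡+n a)

  crossed≡ : ∀ n d → + n ℤ.* + suc (d * 1) ≡ + (n * suc d)
  crossed≡ n d = trans (sym (ℤ.pos-* n (suc (d * 1)))) (cong (λ e → + (n * suc e)) (*-identityʳ d))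

scaled-≤⇔ : ∀ p d .(c : Coprime p (suc d)) m n →
  (mkℚ (+ p) d c ℚ.* toℚ m ℚ.≤ toℚ n) ⇔ (p * m ≤ n * suc d)
scaled-≤⇔ p d c m n rewrite toℚ-reduced m | toℚ-reduced n = mk⇔ to from
  where
  r = mkℚ (+ p) d c
  m/1 = mkℚ (+ m) 0 (coprime-1 m)
  to : r ℚ.* m/1 ℚ.≤ mkℚ (+ n) 0 (coprime-1 n) → p * m ≤ n * suc d
  to r*m≤n with ℚᵘ.≤-trans (ℚᵘ.≤-reflexive (ℚᵘ.≃-sym (ℚ.toℚᵘ-homo-* r m/1))) (ℚ.toℚᵘ-mono-≤ r*m≤n)
  ... | ℚᵘ.*≤* cross = ℤ.drop‿+≤+ (subst₂ ℤ._≤_ (numerator≡ (p * m)) (crossed≡ n d) cross)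
  from : p * m ≤ n * suc d → r ℚ.* m/1 ℚ.≤ mkℚ (+ n) 0 (coprime-1 n)
  from pm≤nd = ℚ.toℚᵘ-cancel-≤ (ℚᵘ.≤-trans (ℚᵘ.≤-reflexive (ℚ.toℚᵘ-homo-* r m/1))
    (ℚᵘ.*≤* (subst₂ ℤ._≤_ (sym (numerator≡ (p * m))) (sym (crossed≡ n d)) (+≤+ pm≤nd))))

scaled-≥ : ∀ p d .(c : Coprime p (suc d)) m n →
  n * suc d ≤ p * m → toℚ n ℚ.≤ mkℚ (+ p) d c ℚ.* toℚ m
scaled-≥ p d c m n nd≤pm rewrite toℚ-reduced m | toℚ-reduced n =
  ℚ.toℚᵘ-cancel-≤ (ℚᵘ.≤-trans
    (ℚᵘ.*≤* (subst₂ ℤ._≤_ (sym (crossed≡ n d)) (sym (numerator≡ (p * m))) (+≤+ nd≤pm)))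
    (ℚᵘ.≤-reflexive (ℚᵘ.≃-sym (ℚ.toℚᵘ-homo-* (mkℚ (+ p) d c) (mkℚ (+ m) 0 (coprime-1 m))))))

RatLower : (ℕ → ℕ) → (ℕ → ℕ) → Set
RatLower m n = Σ ℚ λ c → (0ℚ ℚ.< c) × Eventually (λ x → c ℚ.* toℚ (m x) ℚ.≤ toℚ (n x))

NatLower : (ℕ → ℕ) → (ℕ → ℕ) → Set
NatLower m n = Σ ℕ λ Q → Eventually (λ x → m x ≤ n x * Q)

-- The two notions agree: a positive rational p/(1+d) may be replaced by
-- 1/(1+d), and conversely Q by 1/(1+Q).
ratLower⇔natLower : ∀ m n → RatLower m n ⇔ NatLower m n
ratLower⇔natLower m n = mk⇔ to from
  where
  to : RatLower m n → NatLower m n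
  to (mkℚ (+ zero) d c , ℚ.*<* (+<+ ()) , _)
  to (mkℚ ℤ.-[1+ _ ] d c , ℚ.*<* () , _)
  to (mkℚ (+ suc p) d c , _ , ev) = suc d , eventually-map
    (λ x cm≤n → ≤-trans (m≤n*m (m x) (suc p)) (Equivalence.to (scaled-≤⇔ (suc p) d c (m x) (n x)) cm≤n))
    ev
  from : NatLower m n → RatLower m n
  from (Q , ev) = mkℚ (+ 1) Q (Coprimality.1-coprimeTo _) , ℚ.*<* (+<+ (s≤s z≤n)) , eventually-map
    (λ x m≤nQ → Equivalence.from (scaled-≤⇔ 1 Q _ (m x) (n x))
      (≤-trans (≤-reflexive (*-identityˡ (m x))) (≤-trans m≤nQ (*-monoʳ-≤ (n x) (n≤1+n Q)))))
    ev

T : ℕ → ℕ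
T = S (λ n → n)

open ≤-Reasoning

T≤square : ∀ N → T N ≤ N * N
T≤square zero = z≤n
T≤square (suc N) = begin
  T N + suc N            ≤⟨ +-monoˡ-≤ (suc N) (T≤square N) ⟩
  N * N + suc N          ≤⟨ m≤m+n _ N ⟩
  N * N + suc N + N      ≡⟨ expand N ⟩
  suc N * suc N          ∎
  where
  expand : ∀ N → N * N + suc N + N ≡ suc N * suc N
  expand = solve-∀

square≤2T : ∀ N → N * N ≤ 2 * T N
square≤2T zero = z≤n
square≤2T (suc N) = begin
  suc N * suc N          ≤⟨ n≤1+n _ ⟩
  suc (suc N * suc N)    ≡⟨ expand N ⟩
  N * N + 2 * suc N      ≤⟨ +-monoˡ-≤ (2 * suc N) (square≤2T N) ⟩
  2 * T N + 2 * suc N    ≡⟨ *-distribˡ-+ 2 (T N) (suc N) ⟨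
  2 * (T N + suc N)      ∎
  where
  expand : ∀ N → suc (suc N * suc N) ≡ N * N + 2 * suc N
  expand = solve-∀

S≤T : ∀ f → (∀ n → f n ≤ n) → ∀ N → S f N ≤ T N
S≤T f f≤id zero = z≤n
S≤T f f≤id (suc N) = +-mono-≤ (S≤T f f≤id N) (f≤id (suc N))

S-mono : ∀ f {M N} → M ≤ N → S f M ≤ S f N
S-mono f {N = zero} z≤n = ≤-refl
S-mono f {M} {suc N} M≤1+N with m≤n⇒m<n∨m≡n M≤1+N
... | inj₁ (s≤s M≤N) = ≤-trans (S-mono f M≤N) (m≤m+n (S f N) (f (suc N)))
... | inj₂ refl = ≤-refl

F≤square : ∀ f → (∀ n → f n ≤ n) → ∀ k t → F f k t ≤ k ^ suc t * k ^ suc t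
F≤square f f≤id k t =
  ≤-trans (m∸n≤m _ (S f (k ^ t))) (≤-trans (S≤T f f≤id (k ^ suc t)) (T≤square (k ^ suc t)))

S-split : ∀ f k m → .{{_ : NonZero k}} → S f (k * m) ≡ (S f (k * m) ∸ S f m) + S f m
S-split f k m = sym (m∸n+n≡m (S-mono f (m≤n*m m k)))

square : ∀ x → x ^ 2 ≡ x * x
square x = cong (x *_) (*-identityʳ x)

strict-growth : ∀ g → (∀ t → g t < g (suc t)) → ∀ t n → n + g t ≤ g (t + n)
strict-growth g inc t zero = ≤-reflexive (cong g (sym (+-identityʳ t)))
strict-growth g inc t (suc n) = begin
  suc (n + g t)     ≤⟨ s≤s (strict-growth g inc t n) ⟩
  suc (g (t + n))   ≤⟨ inc (t + n) ⟩
  g (suc (t + n))   ≡⟨ cong g (+-suc t n) ⟨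
  g (t + suc n)     ∎

bracket : ∀ g → (∀ t → g t < g (suc t)) → ∀ t₀ N → g t₀ ≤ N →
  Σ ℕ λ t → t₀ ≤ t × g t ≤ N × N < g (suc t)
bracket g inc t₀ N gt₀≤N = search (suc N) t₀ ≤-refl gt₀≤N (<-≤-trans N<1+N+g (strict-growth g inc t₀ (suc N)))
  where
  N<1+N+g : N < suc N + g t₀
  N<1+N+g = s≤s (m≤m+n N (g t₀))
  -- Walk upwards from t while g (t+1) ≤ N; `n` bounds the remaining steps.
  search : ∀ n t → t₀ ≤ t → g t ≤ N → N < g (t + n) →
    Σ ℕ λ t → t₀ ≤ t × g t ≤ N × N < g (suc t)
  search zero t _ gt≤N N<g = contradiction (subst (λ u → N < g u) (+-identityʳ t) N<g) (≤⇒≯ gt≤N)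
  search (suc n) t t₀≤t gt≤N N<g with N <? g (suc t)
  ... | yes N<g′ = t , t₀≤t , gt≤N , N<g′
  ... | no N≮g′ = search n (suc t) (≤-trans t₀≤t (n≤1+n t)) (≮⇒≥ N≮g′) (subst (λ u → N < g u) (+-suc t n) N<g)

powers-increasing : ∀ k → 1 < k → ∀ t → k ^ suc t < k ^ suc (suc t)
powers-increasing k 1<k t = ^-monoʳ-< k 1<k (n<1+n (suc t))

index≤power : ∀ k → 1 < k → ∀ t → t ≤ k ^ suc t
index≤power k 1<k t = ≤-trans (m≤m+n t _) (strict-growth (λ s → k ^ suc s) (powers-increasing k 1<k) 0 t)

-- Arithmetic core: with k = 4(q+1) and K = k·m, the bounds K² ≤ 2(q+1)(F + B)
-- and B ≤ m² leave room only for K² ≤ k·F, because k·m² ≤ K².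
large-block : ∀ q m F B → let k = 4 * suc q ; K = k * m in
  K * K ≤ 2 * ((F + B) * suc q) → B ≤ m * m → K * K ≤ F * k
large-block q m F B K²≤total B≤m² = +-cancelʳ-≤ (K * K) (K * K) (F * k) (begin
  K * K + K * K                ≡⟨ double (K * K) ⟩
  2 * (K * K)                  ≤⟨ *-monoʳ-≤ 2 K²≤total ⟩
  2 * (2 * ((F + B) * suc q))  ≡⟨ distribute F B (suc q) ⟩
  F * k + k * B                ≤⟨ +-monoʳ-≤ (F * k) (*-monoʳ-≤ k B≤m²) ⟩
  F * k + k * (m * m)          ≡⟨ cong (_+_ (F * k)) (*-assoc k m m) ⟨
  F * k + K * m                ≤⟨ +-monoʳ-≤ (F * k) (*-monoʳ-≤ K (m≤n*m m k)) ⟩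
  F * k + K * K                ∎)
  where
  k = 4 * suc q
  K = k * m
  double : ∀ x → x + x ≡ 2 * x
  double = solve-∀
  distribute : ∀ F B Q → 2 * (2 * ((F + B) * Q)) ≡ F * (4 * Q) + 4 * Q * B
  distribute = solve-∀

base>1 : ∀ q → 1 < 4 * suc q
base>1 q = ≤-trans (s≤s (s≤s z≤n)) (m≤m*n 4 (suc q))

blocks-large : ∀ f → (∀ n → f n ≤ n) → ∀ q → Eventually (λ N → T N ≤ S f N * q) →
  let k = 4 * suc q in Eventually (λ t → (k ^ suc t) ^ 2 ≤ F f k t * k)
blocks-large f f≤id q (N₀ , avg) = N₀ , λ t N₀≤t →
  subst (_≤ F f k t * k) (sym (square (k ^ suc t)))
    (large-block q (k ^ t) (F f k t) (S f (k ^ t)) (total t N₀≤t) (≤-trans (S≤T f f≤id (k ^ t)) (T≤square (k ^ t))))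
  where
  k = 4 * suc q
  total : ∀ t → N₀ ≤ t → k ^ suc t * k ^ suc t ≤ 2 * ((F f k t + S f (k ^ t)) * suc q)
  total t N₀≤t = begin
    k ^ suc t * k ^ suc t          ≤⟨ square≤2T (k ^ suc t) ⟩
    2 * T (k ^ suc t)              ≤⟨ *-monoʳ-≤ 2 (avg (k ^ suc t) (≤-trans N₀≤t (index≤power k (base>1 q) t))) ⟩
    2 * (S f (k ^ suc t) * q)      ≤⟨ *-monoʳ-≤ 2 (*-monoʳ-≤ (S f (k ^ suc t)) (n≤1+n q)) ⟩
    2 * (S f (k ^ suc t) * suc q)  ≡⟨ cong (λ s → 2 * (s * suc q)) (S-split f k (k ^ t)) ⟩
    2 * ((F f k t + S f (k ^ t)) * suc q) ∎

-- Under the same hypothesis the late block sums at least double: since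
-- F_t ≤ N_(t+1)² and k · N_(t+1)² ≤ F_(t+1), we get 2 F_t ≤ F_(t+1).
blocks-doubling : ∀ f → (∀ n → f n ≤ n) → ∀ q → Eventually (λ N → T N ≤ S f N * q) →
  let k = 4 * suc q in Eventually (λ t → F f k t * 2 ≤ F f k (suc t))
blocks-doubling f f≤id q avg with blocks-large f f≤id q avg
... | t₀ , large = t₀ , λ t t₀≤t → begin
  F f k t * 2                 ≡⟨ *-comm (F f k t) 2 ⟩
  2 * F f k t                 ≤⟨ *-monoʳ-≤ 2 (F≤square f f≤id k t) ⟩
  2 * (K t * K t)             ≤⟨ *-cancelˡ-≤ k (next t (≤-trans t₀≤t (n≤1+n t))) ⟩
  F f k (suc t)               ∎
  where
  k = 4 * suc q
  K : ℕ → ℕ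
  K t = k ^ suc t
  regroup : ∀ k K → (k * K) * (k * K) ≡ k * (k * (K * K))
  regroup = solve-∀
  next : ∀ t → t₀ ≤ suc t → k * (2 * (K t * K t)) ≤ k * F f k (suc t)
  next t t₀≤1+t = begin
    k * (2 * (K t * K t))       ≤⟨ *-monoʳ-≤ k (*-monoˡ-≤ (K t * K t) (base>1 q)) ⟩
    k * (k * (K t * K t))       ≡⟨ regroup k (K t) ⟨
    K (suc t) * K (suc t)       ≡⟨ square (K (suc t)) ⟨
    K (suc t) ^ 2               ≤⟨ large (suc t) t₀≤1+t ⟩
    F f k (suc t) * k           ≡⟨ *-comm (F f k (suc t)) k ⟩
    k * F f k (suc t)           ∎

-- If N_(t+1)² ≤ Q · F_t for all large t, then T N ≤ k²Q · S f N for all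
-- large N: bracket N_(t+1) ≤ N < N_(t+2) and use T N ≤ N² ≤ k² N_(t+1)².
avg-from-blocks : ∀ f k → 1 < k → ∀ Q → Eventually (λ t → (k ^ suc t) ^ 2 ≤ F f k t * Q) →
  Eventually (λ N → T N ≤ S f N * (k * k * Q))
avg-from-blocks f k 1<k Q (t₀ , blocks) = k ^ suc t₀ , bound
  where
  regroup : ∀ k K → (k * K) * (k * K) ≡ k * k * (K * K)
  regroup = solve-∀
  reassociate : ∀ k s Q → k * k * (s * Q) ≡ s * (k * k * Q)
  reassociate = solve-∀
  bound : ∀ N → k ^ suc t₀ ≤ N → T N ≤ S f N * (k * k * Q)
  bound N N₀≤N with bracket (λ t → k ^ suc t) (powers-increasing k 1<k) t₀ N N₀≤N
  ... | t , t₀≤t , K≤N , N<kK = begin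
    T N                               ≤⟨ T≤square N ⟩
    N * N                             ≤⟨ *-mono-≤ (<⇒≤ N<kK) (<⇒≤ N<kK) ⟩
    (k * k ^ suc t) * (k * k ^ suc t) ≡⟨ regroup k (k ^ suc t) ⟩
    k * k * (k ^ suc t * k ^ suc t)   ≡⟨ cong (k * k *_) (square (k ^ suc t)) ⟨
    k * k * (k ^ suc t) ^ 2           ≤⟨ *-monoʳ-≤ (k * k) (blocks t t₀≤t) ⟩
    k * k * (F f k t * Q)             ≤⟨ *-monoʳ-≤ (k * k) (*-monoˡ-≤ Q block≤S) ⟩
    k * k * (S f N * Q)               ≡⟨ reassociate k (S f N) Q ⟩
    S f N * (k * k * Q)               ∎
    where
    block≤S : F f k t ≤ S f N
    block≤S = ≤-trans (m∸n≤m _ (S f (k ^ t))) (S-mono f K≤N)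

doubling⇒ratio : ∀ f k → Eventually (λ t → F f k t * 2 ≤ F f k (suc t)) → BlockRatio f k
doubling⇒ratio f k doubling = ½ , ℚ.*<* (+<+ (s≤s z≤n)) , ℚ.*<* (+<+ (s≤s (s≤s z≤n))) ,
  eventually-map (λ t 2F≤F′ → scaled-≥ 1 1 (Coprimality.1-coprimeTo 2) (F f k (suc t)) (F f k t)
                    (≤-trans 2F≤F′ (≤-reflexive (sym (*-identityˡ _)))))
    doubling

lemma5p1 : (f : ℕ → ℕ) → (∀ n → f n ≤ n) →
    (AvgLinear f ⇔ Σ ℕ (λ k → (1 < k) × BlockLower f k))
    × (AvgLinear f → Σ ℕ (λ k → (1 < k) × BlockLower f k × BlockRatio f k))
lemma5p1 f f≤id = mk⇔ (λ avg → let k , 1<k , lower , _ = avg⇒blocks avg in k , 1<k , lower) blocks⇒avg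
                , avg⇒blocks
  where
  avg⇒blocks : AvgLinear f → Σ ℕ (λ k → (1 < k) × BlockLower f k × BlockRatio f k)
  avg⇒blocks avg with Equivalence.to (ratLower⇔natLower T (S f)) avg
  ... | q , bound =
    4 * suc q , base>1 q ,
    Equivalence.from (ratLower⇔natLower _ (F f (4 * suc q))) (4 * suc q , blocks-large f f≤id q bound) ,
    doubling⇒ratio f (4 * suc q) (blocks-doubling f f≤id q bound)
  blocks⇒avg : Σ ℕ (λ k → (1 < k) × BlockLower f k) → AvgLinear f
  blocks⇒avg (k , 1<k , lower) with Equivalence.to (ratLower⇔natLower _ (F f k)) lower
  ... | Q , bound = Equivalence.from (ratLower⇔natLower T (S f)) (k * k * Q , avg-from-blocks f k 1<k Q bound)
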